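{- For all finite sets $C,D,E\subseteq\mathbb{C}$ the following formulas are semantically valid (true at every state of every model) and derivable in $\mathbb{SPIL}_1$: (projectivity) $\mathit{Kv}(C,D)$ whenever $D\subseteq C$; (transitivity) $\mathit{Kv}(C,D)\land\mathit{Kv}(D,E)\to\mathit{Kv}(C,E)$; (additivity) $\mathit{Kv}(C,D)\land\mathit{Kv}(C,E)\to\mathit{Kv}(C,D\cup E)$.
   Context: Fix a set of constants $\mathbb{C}$. The language $\mathcal{L}_1$ is given by $\varphi ::= \top \mid \lnot\varphi \mid \varphi\land\varphi \mid \mathit{Kv}(c) \mid [c]\varphi$ with $c\in\mathbb{C}$; $\langle c\rangle\varphi:=\lnot[c]\lnot\varphi$. A model is $\mathcal{M}=\langle S,\mathcal{D},V\rangle$ with $S$ a non-empty set of states, $\mathcal{D}$ a non-empty domain, $V:S\times\mathbb{C}\to\mathcal{D}$; $s=_c t$ means $V(s,c)=V(t,c)$. Semantics: booleans as usual; $\mathcal{M},s\vDash\mathit{Kv}(c)$ iff $s=_c t$ for all $t\in S$; $\mathcal{M},s\vDash[c]\varphi$ iff $\mathcal{M}|^s_c,s\vDash\varphi$, where $\mathcal{M}|^s_c$ restricts $S$ to $\{t\in S\mid s=_c t\}$ (and $V$ accordingly). For finite $C=\{c_1,\dots,c_m\}$, $D=\{d_1,\dots,d_n\}$, $\mathit{Kv}(C,D):=[c_1]\dots[c_m](\mathit{Kv}(d_1)\land\dots\land\mathit{Kv}(d_n))$ (empty box prefix omitted, empty conjunction $=\top$). The proof system $\mathbb{SPIL}_1$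 has axioms TAUT (propositional tautologies), DIST $[c](\varphi\to\psi)\to([c]\varphi\to[c]\psi)$, LEARN $[c]\mathit{Kv}(c)$, NF $\mathit{Kv}(c)\to[d]\mathit{Kv}(c)$, DET $\langle c\rangle\varphi\leftrightarrow[c]\varphi$, COMM $[c][d]\varphi\leftrightarrow[d][c]\varphi$, IR $\mathit{Kv}(c)\to([c]\varphi\to\varphi)$, and rules MP and NEC (from $\varphi$ infer $[c]\varphi$). -}

module Defs where

open import Data.Bool using (Bool; true; false; not; _∧_)
open import Data.List using (List; []; _∷_)
open import Data.Product using (Σ; _,_; _×_)
open import Relation.Binary.PropositionalEquality using (_≡_; refl)
open import Relation.Nullary using (¬_)

module Logic (Const : Set) where

  infixr 6 _∧'_

  data Form : Set where
    ⊤'   : Form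
    ¬'_  : Form → Form
    _∧'_ : Form → Form → Form
    Kv   : Const → Form
    [_]_ : Const → Form → Form

  ⟨_⟩_ : Const → Form → Form
  ⟨ c ⟩ φ = ¬' ([ c ] (¬' φ))

  _⇒_ : Form → Form → Form
  φ ⇒ ψ = ¬' (φ ∧' ¬' ψ)

  _⇔_ : Form → Form → Form
  φ ⇔ ψ = (φ ⇒ ψ) ∧' (ψ ⇒ φ)

  -- Kv(c₁..cₘ , d₁..dₙ) := [c₁]…[cₘ](Kv d₁ ∧ … ∧ Kv dₙ)
  KvConj : List Const → Form
  KvConj []       = ⊤'
  KvConj (d ∷ []) = Kv d
  KvConj (d ∷ ds@(_ ∷ _)) = Kv d ∧' KvConj ds

  boxes : List Const → Form → Form
  boxes []       φ = φ
  boxes (c ∷ cs) φ = [ c ] boxes cs φ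

  KvS : List Const → List Const → Form
  KvS C D = boxes C (KvConj D)

  record Model : Set₁ where
    field
      S  : Set
      Dom : Set
      V  : S → Const → Dom
      s₀ : S      -- S non-empty
      d₀ : Dom    -- domain non-empty

  open Model public

  restrict : (M : Model) → S M → Const → Model
  restrict M s c = record
    { S   = Σ (S M) (λ t → V M s c ≡ V M t c)
    ; Dom = Dom M
    ; V   = λ t d → V M (Σ.proj₁ t) d
    ; s₀  = s , refl
    ; d₀  = d₀ M
    }

  _,_⊨_ : (M : Model) → S M → Form → Set
  M , s ⊨ ⊤'       = Data.Unit.⊤ where import Data.Unit
  M , s ⊨ (¬' φ)   = ¬ (M , s ⊨ φ)
  M , s ⊨ (φ ∧' ψ) = (M , s ⊨ φ) × (M , s ⊨ ψ)
  M , s ⊨ Kv c     = ∀ t → V M s c ≡ V M t c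
  M , s ⊨ ([ c ] φ) = restrict M s c , (s , refl) ⊨ φ

  Valid : Form → Set₁
  Valid φ = ∀ (M : Model) (s : S M) → M , s ⊨ φ

  -- Propositional tautologies: true under every Boolean valuation of the
  -- atoms (formulas Kv c and [c]ψ are treated as propositional atoms).
  evalB : (Form → Bool) → Form → Bool
  evalB v ⊤'        = true
  evalB v (¬' φ)    = not (evalB v φ)
  evalB v (φ ∧' ψ)  = evalB v φ ∧ evalB v ψ
  evalB v (Kv c)    = v (Kv c)
  evalB v ([ c ] φ) = v ([ c ] φ)

  Tautology : Form → Set
  Tautology φ = ∀ (v : Form → Bool) → evalB v φ ≡ true

  data ⊢_ : Form → Set where
    TAUT  : ∀ {φ} → Tautology φ → ⊢ φ
    DIST  : ∀ {c φ ψ} → ⊢ (([ c ] (φ ⇒ ψ)) ⇒ (([ c ] φ) ⇒ ([ c ] ψ)))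
    LEARN : ∀ {c} → ⊢ ([ c ] Kv c)
    NF    : ∀ {c d} → ⊢ (Kv c ⇒ ([ d ] Kv c))
    DET   : ∀ {c φ} → ⊢ ((⟨ c ⟩ φ) ⇔ ([ c ] φ))
    COMM  : ∀ {c d φ} → ⊢ (([ c ] ([ d ] φ)) ⇔ ([ d ] ([ c ] φ)))
    IR    : ∀ {c φ} → ⊢ (Kv c ⇒ (([ c ] φ) ⇒ φ))
    MP    : ∀ {φ ψ} → ⊢ (φ ⇒ ψ) → ⊢ φ → ⊢ ψ
    NEC   : ∀ {c φ} → ⊢ φ → ⊢ ([ c ] φ)

-- A state satisfies Kv(C, D) exactly when every state agreeing with it on the
-- values of C also agrees on the values of D; projectivity, transitivity and
-- additivity are then immediate facts about agreement on lists of constants.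
-- Syntactically, LEARN and NF give Kv(c) under any boxes once c has been
-- announced, NF and COMM make formulas Kv(D, E) persist under announcements,
-- and IR discharges the boxes [d] of Kv(D, E) once every Kv(d) is known.
module Submission where

open import Defs
open import Data.Bool using (Bool; true; false; not; _∧_)
open import Data.List using (List; []; _∷_; _++_)
open import Data.List.Membership.Propositional using (_∈_)
open import Data.List.Relation.Binary.Subset.Propositional using (_⊆_)
open import Data.List.Relation.Unary.All as All using (All; []; _∷_)
open import Data.List.Relation.Unary.All.Properties using (++⁺)
open import Data.List.Relation.Unary.Any using (here; there)
open import Data.Product using (_×_; _,_)
open import Data.Unit using (tt)
open import Function using (_∘_)
open import Relation.Binary.PropositionalEquality using (_≡_; refl)

-- Definitionally what evalB computes for _⇒_, so truth tables stated with it
-- apply to evalB directly.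
_⇒ᵇ_ : Bool → Bool → Bool
a ⇒ᵇ b = not (a ∧ not b)

module _ {Const : Set} where
  open Logic Const

  private
    variable
      c : Const
      φ ψ χ φ′ ψ′ : Form

  ⊢⊤ : ⊢ ⊤'
  ⊢⊤ = TAUT λ _ → refl

  ⊢⇒-refl : ⊢ (φ ⇒ φ)
  ⊢⇒-refl {φ} = TAUT λ v → refl′ (evalB v φ)
    where
    refl′ : ∀ a → (a ⇒ᵇ a) ≡ true
    refl′ true  = refl
    refl′ false = refl

  ⊢∧-proj₁ : ⊢ ((φ ∧' ψ) ⇒ φ)
  ⊢∧-proj₁ {φ} {ψ} = TAUT λ v → proj₁′ (evalB v φ) (evalB v ψ)
    where
    proj₁′ : ∀ a b → ((a ∧ b) ⇒ᵇ a) ≡ true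
    proj₁′ true  true  = refl
    proj₁′ true  false = refl
    proj₁′ false b     = refl

  ⊢∧-proj₂ : ⊢ ((φ ∧' ψ) ⇒ ψ)
  ⊢∧-proj₂ {φ} {ψ} = TAUT λ v → proj₂′ (evalB v φ) (evalB v ψ)
    where
    proj₂′ : ∀ a b → ((a ∧ b) ⇒ᵇ b) ≡ true
    proj₂′ true  true  = refl
    proj₂′ true  false = refl
    proj₂′ false b     = refl

  ⊢⇒-const : ⊢ (ψ ⇒ (φ ⇒ ψ))
  ⊢⇒-const {ψ} {φ} = TAUT λ v → const′ (evalB v ψ) (evalB v φ)
    where
    const′ : ∀ b a → (b ⇒ᵇ (a ⇒ᵇ b)) ≡ true
    const′ true  true  = refl
    const′ true  false = refl
    const′ false a     = refl

  ⊢∧-intro : ⊢ (φ ⇒ (ψ ⇒ (φ ∧' ψ)))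
  ⊢∧-intro {φ} {ψ} = TAUT λ v → intro′ (evalB v φ) (evalB v ψ)
    where
    intro′ : ∀ a b → (a ⇒ᵇ (b ⇒ᵇ (a ∧ b))) ≡ true
    intro′ true  true  = refl
    intro′ true  false = refl
    intro′ false b     = refl

  ⊢⇒-trans : ⊢ ((φ ⇒ ψ) ⇒ ((ψ ⇒ χ) ⇒ (φ ⇒ χ)))
  ⊢⇒-trans {φ} {ψ} {χ} = TAUT λ v → trans′ (evalB v φ) (evalB v ψ) (evalB v χ)
    where
    trans′ : ∀ a b c → ((a ⇒ᵇ b) ⇒ᵇ ((b ⇒ᵇ c) ⇒ᵇ (a ⇒ᵇ c))) ≡ true
    trans′ true  true  true  = refl
    trans′ true  true  false = refl
    trans′ true  false true  = refl
    trans′ true  false false = refl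
    trans′ false true  true  = refl
    trans′ false true  false = refl
    trans′ false false true  = refl
    trans′ false false false = refl

  ⊢⇒-pair : ⊢ ((φ ⇒ ψ) ⇒ ((φ ⇒ χ) ⇒ (φ ⇒ (ψ ∧' χ))))
  ⊢⇒-pair {φ} {ψ} {χ} = TAUT λ v → pair′ (evalB v φ) (evalB v ψ) (evalB v χ)
    where
    pair′ : ∀ a b c → ((a ⇒ᵇ b) ⇒ᵇ ((a ⇒ᵇ c) ⇒ᵇ (a ⇒ᵇ (b ∧ c)))) ≡ true
    pair′ true  true  true  = refl
    pair′ true  true  false = refl
    pair′ true  false true  = refl
    pair′ true  false false = refl
    pair′ false true  true  = refl
    pair′ false true  false = refl
    pair′ false false true  = refl
    pair′ false false false = refl

  ⊢⇒-uncurry : ⊢ ((φ ⇒ (ψ ⇒ χ)) ⇒ ((φ ∧' ψ) ⇒ χ))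
  ⊢⇒-uncurry {φ} {ψ} {χ} = TAUT λ v → uncurry′ (evalB v φ) (evalB v ψ) (evalB v χ)
    where
    uncurry′ : ∀ a b c → ((a ⇒ᵇ (b ⇒ᵇ c)) ⇒ᵇ ((a ∧ b) ⇒ᵇ c)) ≡ true
    uncurry′ true  true  true  = refl
    uncurry′ true  true  false = refl
    uncurry′ true  false true  = refl
    uncurry′ true  false false = refl
    uncurry′ false true  true  = refl
    uncurry′ false true  false = refl
    uncurry′ false false true  = refl
    uncurry′ false false false = refl

  infixr 4 _⟫_

  _⟫_ : ⊢ (φ ⇒ ψ) → ⊢ (ψ ⇒ χ) → ⊢ (φ ⇒ χ)
  p ⟫ q = MP (MP ⊢⇒-trans p) q

  ⇒-pair : ⊢ (φ ⇒ ψ) → ⊢ (φ ⇒ χ) → ⊢ (φ ⇒ (ψ ∧' χ))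
  ⇒-pair p q = MP (MP ⊢⇒-pair p) q

  ⇒-uncurry : ⊢ (φ ⇒ (ψ ⇒ χ)) → ⊢ ((φ ∧' ψ) ⇒ χ)
  ⇒-uncurry = MP ⊢⇒-uncurry

  ⇒-const : ⊢ ψ → ⊢ (φ ⇒ ψ)
  ⇒-const = MP ⊢⇒-const

  ∧-intro : ⊢ φ → ⊢ ψ → ⊢ (φ ∧' ψ)
  ∧-intro p q = MP (MP ⊢∧-intro p) q

  ∧-map : ⊢ (φ ⇒ φ′) → ⊢ (ψ ⇒ ψ′) → ⊢ ((φ ∧' ψ) ⇒ (φ′ ∧' ψ′))
  ∧-map p q = ⇒-pair (⊢∧-proj₁ ⟫ p) (⊢∧-proj₂ ⟫ q)

  ∧-assoc : ⊢ (((φ ∧' ψ) ∧' χ) ⇒ (φ ∧' (ψ ∧' χ)))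
  ∧-assoc = ⇒-pair (⊢∧-proj₁ ⟫ ⊢∧-proj₁) (∧-map ⊢∧-proj₂ ⊢⇒-refl)

  □-mono : ⊢ (φ ⇒ ψ) → ⊢ (([ c ] φ) ⇒ ([ c ] ψ))
  □-mono p = MP DIST (NEC p)

  □-∧ : ⊢ ((([ c ] φ) ∧' ([ c ] ψ)) ⇒ ([ c ] (φ ∧' ψ)))
  □-∧ = ⇒-uncurry (□-mono ⊢∧-intro ⟫ DIST)

  boxes-nec : ∀ C → ⊢ φ → ⊢ boxes C φ
  boxes-nec []      p = p
  boxes-nec (_ ∷ C) p = NEC (boxes-nec C p)

  boxes-mono : ∀ C → ⊢ (φ ⇒ ψ) → ⊢ (boxes C φ ⇒ boxes C ψ)
  boxes-mono []      p = p
  boxes-mono (_ ∷ C) p = □-mono (boxes-mono C p)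

  boxes-∧ : ∀ C → ⊢ ((boxes C φ ∧' boxes C ψ) ⇒ boxes C (φ ∧' ψ))
  boxes-∧ []      = ⊢⇒-refl
  boxes-∧ (_ ∷ C) = □-∧ ⟫ □-mono (boxes-∧ C)

  boxes-comm : ∀ D → ⊢ (boxes D ([ c ] φ) ⇒ ([ c ] boxes D φ))
  boxes-comm []      = ⊢⇒-refl
  boxes-comm (_ ∷ D) = □-mono (boxes-comm D) ⟫ MP ⊢∧-proj₁ COMM

  -- KvConj treats singletons specially; these two lemmas hide that.
  KvConj-uncons : ∀ d ds → ⊢ (KvConj (d ∷ ds) ⇒ (Kv d ∧' KvConj ds))
  KvConj-uncons d []      = ⇒-pair ⊢⇒-refl (⇒-const ⊢⊤)
  KvConj-uncons d (_ ∷ _) = ⊢⇒-refl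

  KvConj-cons : ∀ d ds → ⊢ ((Kv d ∧' KvConj ds) ⇒ KvConj (d ∷ ds))
  KvConj-cons d []      = ⊢∧-proj₁
  KvConj-cons d (_ ∷ _) = ⊢⇒-refl

  KvConj-++ : ∀ D E → ⊢ ((KvConj D ∧' KvConj E) ⇒ KvConj (D ++ E))
  KvConj-++ []       E = ⊢∧-proj₂
  KvConj-++ (d ∷ ds) E =
    ∧-map (KvConj-uncons d ds) ⊢⇒-refl ⟫ ∧-assoc ⟫
    ∧-map ⊢⇒-refl (KvConj-++ ds E) ⟫ KvConj-cons d (ds ++ E)

  Persistent : Form → Set
  Persistent φ = ∀ {c} → ⊢ (φ ⇒ ([ c ] φ))

  ∧-persistent : Persistent φ → Persistent ψ → Persistent (φ ∧' ψ)
  ∧-persistent p q = ∧-map p q ⟫ □-∧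

  KvConj-persistent : ∀ D → Persistent (KvConj D)
  KvConj-persistent []       = ⇒-const (NEC ⊢⊤)
  KvConj-persistent (d ∷ ds) =
    KvConj-uncons d ds ⟫ ∧-persistent NF (KvConj-persistent ds) ⟫ □-mono (KvConj-cons d ds)

  boxes-persistent : ∀ D → Persistent φ → Persistent (boxes D φ)
  boxes-persistent D p = boxes-mono D p ⟫ boxes-comm D

  persistent⇒boxes : Persistent φ → ∀ C → ⊢ (φ ⇒ boxes C φ)
  persistent⇒boxes p []      = ⊢⇒-refl
  persistent⇒boxes p (_ ∷ C) = p ⟫ □-mono (persistent⇒boxes p C)

  Kv-boxes : ∀ {d C} → d ∈ C → ⊢ boxes C (Kv d)
  Kv-boxes {C = _ ∷ C} (here refl) = MP (□-mono (persistent⇒boxes NF C)) LEARN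
  Kv-boxes                (there p) = NEC (Kv-boxes p)

  KvConj-boxes-elim : ∀ D → ⊢ ((KvConj D ∧' boxes D φ) ⇒ φ)
  KvConj-boxes-elim []       = ⊢∧-proj₂
  KvConj-boxes-elim (d ∷ ds) =
    ∧-map (KvConj-uncons d ds) ⊢⇒-refl ⟫
    ⇒-pair (⊢∧-proj₁ ⟫ ⊢∧-proj₂) (∧-map ⊢∧-proj₁ ⊢⇒-refl ⟫ ⇒-uncurry IR) ⟫
    KvConj-boxes-elim ds

  KvS-projective : ∀ C D → D ⊆ C → ⊢ KvS C D
  KvS-projective C []       _   = boxes-nec C ⊢⊤
  KvS-projective C (d ∷ ds) D⊆C =
    MP (boxes-∧ C ⟫ boxes-mono C (KvConj-cons d ds))
       (∧-intro (Kv-boxes (D⊆C (here refl))) (KvS-projective C ds (D⊆C ∘ there)))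

  KvS-transitive : ∀ C D E → ⊢ ((KvS C D ∧' KvS D E) ⇒ KvS C E)
  KvS-transitive C D E =
    ∧-map ⊢⇒-refl (persistent⇒boxes (boxes-persistent D (KvConj-persistent E)) C) ⟫
    boxes-∧ C ⟫ boxes-mono C (KvConj-boxes-elim D)

  KvS-additive : ∀ C D E → ⊢ ((KvS C D ∧' KvS C E) ⇒ KvS C (D ++ E))
  KvS-additive C D E = boxes-∧ C ⟫ boxes-mono C (KvConj-++ D E)

  Agree : (M : Model) → S M → S M → List Const → Set
  Agree M s t C = All (λ c → V M s c ≡ V M t c) C

  Determines : (M : Model) → S M → List Const → List Const → Set
  Determines M s C D = ∀ t → Agree M s t C → Agree M s t D

  ⊨KvConj⇒Agree : ∀ D {M s} → M , s ⊨ KvConj D → ∀ t → Agree M s t D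
  ⊨KvConj⇒Agree []                _         t = []
  ⊨KvConj⇒Agree (_ ∷ [])          kv        t = kv t ∷ []
  ⊨KvConj⇒Agree (_ ∷ ds@(_ ∷ _)) (kv , kvs) t = kv t ∷ ⊨KvConj⇒Agree ds kvs t

  Agree⇒⊨KvConj : ∀ D {M s} → (∀ t → Agree M s t D) → M , s ⊨ KvConj D
  Agree⇒⊨KvConj []               _     = tt
  Agree⇒⊨KvConj (_ ∷ [])         agree = All.head ∘ agree
  Agree⇒⊨KvConj (_ ∷ ds@(_ ∷ _)) agree = All.head ∘ agree , Agree⇒⊨KvConj ds (All.tail ∘ agree)

  -- A state of M|^s_c is a pair (t , s =_c t): descending through the boxes
  -- collects the agreement on C one constant at a time.
  ⊨KvS⇒Determines : ∀ C D {M s} → M , s ⊨ KvS C D → Determines M s C D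
  ⊨KvS⇒Determines []      D kv t _          = ⊨KvConj⇒Agree D kv t
  ⊨KvS⇒Determines (_ ∷ C) D kv t (s=t ∷ as) = ⊨KvS⇒Determines C D kv (t , s=t) as

  Determines⇒⊨KvS : ∀ C D {M s} → Determines M s C D → M , s ⊨ KvS C D
  Determines⇒⊨KvS []      D det = Agree⇒⊨KvConj D λ t → det t []
  Determines⇒⊨KvS (_ ∷ C) D det =
    Determines⇒⊨KvS C D λ { (t , s=t) as → det t (s=t ∷ as) }

  KvS-projective-valid : ∀ C D → D ⊆ C → Valid (KvS C D)
  KvS-projective-valid C D D⊆C M s =
    Determines⇒⊨KvS C D λ t as → All.tabulate (All.lookup as ∘ D⊆C)

  KvS-transitive-valid : ∀ C D E → Valid ((KvS C D ∧' KvS D E) ⇒ KvS C E)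
  KvS-transitive-valid C D E M s ((CD , DE) , ¬CE) =
    ¬CE (Determines⇒⊨KvS C E λ t → ⊨KvS⇒Determines D E DE t ∘ ⊨KvS⇒Determines C D CD t)

  KvS-additive-valid : ∀ C D E → Valid ((KvS C D ∧' KvS C E) ⇒ KvS C (D ++ E))
  KvS-additive-valid C D E M s ((CD , CE) , ¬CDE) =
    ¬CDE (Determines⇒⊨KvS C (D ++ E) λ t as →
      ++⁺ (⊨KvS⇒Determines C D CD t as) (⊨KvS⇒Determines C E CE t as))

lemma3 : (Const : Set) → let open Logic Const in
    (C D E : List Const) →
    (D ⊆ C → Valid (KvS C D) × ⊢ KvS C D)
    × (Valid ((KvS C D ∧' KvS D E) ⇒ KvS C E) × ⊢ ((KvS C D ∧' KvS D E) ⇒ KvS C E))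
    × (Valid ((KvS C D ∧' KvS C E) ⇒ KvS C (D ++ E)) × ⊢ ((KvS C D ∧' KvS C E) ⇒ KvS C (D ++ E)))
lemma3 _ C D E =
    (λ D⊆C → KvS-projective-valid C D D⊆C , KvS-projective C D D⊆C)
  , (KvS-transitive-valid C D E , KvS-transitive C D E)
  , (KvS-additive-valid C D E , KvS-additive C D E)
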